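{- Let $Q$ be a connected loop-less quiver with $m$ vertices and $n$ arrows, let $c=n-m+1$, fix an $n\times c$ kernel matrix $K$ of $I(Q)$, and put $K^\dagger=\check G_QK$ and $W=K^{\mathrm{tr}}\check G_QK$. Then the map $\Upsilon:\mathbb{M}_c(\mathbb{Z})\to\mathrm{End}_{ps}(Q)$, $\Upsilon(Z)=\mathrm{Id}_n+KZK^{\dagger\mathrm{tr}}$, is a bijection; denote its inverse by $\Xi$. Moreover, for $B,B'\in\mathrm{End}_{ps}(Q)$: (a) $\Xi(BB')=\Xi(B)+\Xi(B')-\Xi(B)W\Xi(B')$; (b) $\Xi(\mathrm{Id}_n)=0$, and $B$ is $\mathbb{Z}$-invertible if and only if there is $Z\in\mathbb{M}_c(\mathbb{Z})$ with $\Xi(B)+Z-\Xi(B)WZ=0$ (equivalently, with $Z+\Xi(B)-ZW\Xi(B)=0$).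
   Context: A quiver $Q$ has vertices $\{1,\dots,m\}$, arrows $\{1,\dots,n\}$ and source/target maps $s,t$; loop-less: $s(i)\ne t(i)$; connected: underlying graph connected. $I(Q)$ is the $m\times n$ matrix with $i$-th column $\mathbf{e}_{s(i)}-\mathbf{e}_{t(i)}$; $\check G_Q$ is the upper triangular matrix with $\check G_Q+\check G_Q^{\mathrm{tr}}=I(Q)^{\mathrm{tr}}I(Q)$ (it is $\mathbb{Z}$-invertible for loop-less $Q$). The inverse quiver $Q^\dagger$ has incidence matrix $I(Q^\dagger)=I(Q)\check G_Q^{ -1}$. A kernel matrix of $I(Q)$ is a matrix whose columns form a $\mathbb{Z}$-basis of $\ker I(Q)\subseteq\mathbb{Z}^n$ (of rank $n-m+1$ for connected $Q$). $\mathbb{M}_c(\mathbb{Z})$ denotes the $c\times c$ integer matrices. The set of pseudo-endomorphisms of $Q$ is $\mathrm{End}_{ps}(Q)=\{B\in\mathbb{M}_n(\mathbb{Z})\mid I(Q)B=I(Q)\text{ and } I(Q^\dagger)B^{\mathrm{tr}}=I(Q^\dagger)\}$. -}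

module Defs where

open import Data.Nat using (ℕ; zero; suc; _∸_) renaming (_+_ to _+ℕ_)
open import Data.Integer using (ℤ; 0ℤ; 1ℤ; _+_; _-_; _*_)
open import Data.Fin using (Fin; zero; suc; _<_)
open import Data.Fin.Properties using (_≟_)
open import Data.Product using (Σ; ∃; _×_)
open import Relation.Nullary using (¬_; does)
open import Relation.Binary.PropositionalEquality using (_≡_; _≢_)
open import Data.Bool using (if_then_else_)

Mat : ℕ → ℕ → Set
Mat r s = Fin r → Fin s → ℤ

∑ : (k : ℕ) → (Fin k → ℤ) → ℤ
∑ zero    f = 0ℤ
∑ (suc k) f = f zero + ∑ k (λ i → f (suc i))

infixl 7 _·_
infixl 6 _⊕_ _⊖_
infix 4 _≈_

_·_ : ∀ {r s u} → Mat r s → Mat s u → Mat r u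
_·_ {s = s} A B i j = ∑ s (λ k → A i k * B k j)

_⊕_ : ∀ {r s} → Mat r s → Mat r s → Mat r s
(A ⊕ B) i j = A i j + B i j

_⊖_ : ∀ {r s} → Mat r s → Mat r s → Mat r s
(A ⊖ B) i j = A i j - B i j

_ᵀ : ∀ {r s} → Mat r s → Mat s r
(A ᵀ) i j = A j i

𝟘 : ∀ {r s} → Mat r s
𝟘 i j = 0ℤ

Id : ∀ {r} → Mat r r
Id i j = if does (i ≟ j) then 1ℤ else 0ℤ

_≈_ : ∀ {r s} → Mat r s → Mat r s → Set
A ≈ B = ∀ i j → A i j ≡ B i j

Invertible : ∀ {r} → Mat r r → Set
Invertible {r} B = Σ (Mat r r) (λ C → (B · C ≈ Id) × (C · B ≈ Id))

record Quiver : Set where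
  field
    m : ℕ
    n : ℕ
    s : Fin n → Fin m
    t : Fin n → Fin m
open Quiver public

LoopLess : Quiver → Set
LoopLess Q = ∀ i → s Q i ≢ t Q i

data Walk (Q : Quiver) : Fin (m Q) → Fin (m Q) → Set where
  here : ∀ {u} → Walk Q u u
  fwd  : ∀ {u} (a : Fin (n Q)) → Walk Q u (s Q a) → Walk Q u (t Q a)
  bwd  : ∀ {u} (a : Fin (n Q)) → Walk Q u (t Q a) → Walk Q u (s Q a)

Connected : Quiver → Set
Connected Q = ∀ u v → Walk Q u v

Inc : (Q : Quiver) → Mat (m Q) (n Q)
Inc Q v a = Id v (s Q a) - Id v (t Q a)

IsCheckG : (Q : Quiver) → Mat (n Q) (n Q) → Set
IsCheckG Q G = (∀ i j → j < i → G i j ≡ 0ℤ)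
             × (G ⊕ G ᵀ ≈ (Inc Q) ᵀ · Inc Q)

IsInverse : ∀ {r} → Mat r r → Mat r r → Set
IsInverse G Ginv = (G · Ginv ≈ Id) × (Ginv · G ≈ Id)

-- incidence matrix of the inverse quiver: I(Q†) = I(Q) G⁻¹
IncDagger : (Q : Quiver) → Mat (n Q) (n Q) → Mat (m Q) (n Q)
IncDagger Q Ginv = Inc Q · Ginv

corank : Quiver → ℕ
corank Q = (n Q +ℕ 1) ∸ m Q

-- K is a kernel matrix of A: its columns form a Z-basis of ker A ⊆ Zⁿ
-- (column vectors are r×1 matrices)
IsKernelMatrix : ∀ {p r c} → Mat p r → Mat r c → Set
IsKernelMatrix {p} {r} {c} A K =
    (A · K ≈ 𝟘)
  × (∀ (v : Mat r 1) → A · v ≈ 𝟘 → Σ (Mat c 1) (λ z → K · z ≈ v))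
  × (∀ (z : Mat c 1) → K · z ≈ 𝟘 → z ≈ 𝟘)

IsPsEnd : (Q : Quiver) → Mat (n Q) (n Q) → Mat (n Q) (n Q) → Set
IsPsEnd Q Ginv B = (Inc Q · B ≈ Inc Q) × (IncDagger Q Ginv · B ᵀ ≈ IncDagger Q Ginv)

-- Because I K = 0 and G + Gᵀ = Iᵀ I, the matrix W = Kᵀ G K satisfies K†ᵀ K = −W, so
-- Υ X · Υ Y = Υ (X + Y − X W Y): Υ carries the monoid (𝕄_c(ℤ), X ⋆ Y = X + Y − X W Y, 0)
-- into matrix multiplication. It is injective because K and K† = G K are, and every
-- pseudo-endomorphism B is in its image because the two defining equations successively
-- factor B − Id through K†ᵀ and through K. Part (b) then only needs that a one-sided
-- inverse of a square integer matrix is two-sided: any n + 1 vectors of ℤⁿ are dependent,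
-- so if A B = Id every x has a nonzero multiple d x = B w, and d (B A x) = B A B w = d x.

module Submission where

open import Defs
open import Data.Product using (Σ; _×_; _,_; proj₁; proj₂)
open import Function.Bundles using (_⇔_; mk⇔; module Equivalence)
open import Function.Base using (_∘_)
open import Data.Sum using (inj₁; inj₂)
open import Data.Empty using (⊥-elim)
open import Data.Nat using (ℕ; zero; suc)
open import Data.Integer using (ℤ; 0ℤ; _+_; _-_; _*_; -_)
import Data.Integer.Properties as ℤ
open import Data.Integer.Base using (≢-nonZero)
open import Data.Integer.Tactic.RingSolver using (solve-∀)
open import Data.Fin using (Fin; zero; suc; punchIn; punchOut)
open import Data.Fin.Properties using (all?; ¬∀⟶∃¬; punchIn-punchOut)
  renaming (_≟_ to _≟ᶠ_)
open import Level using (0ℓ)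
open import Relation.Binary.Bundles using (Setoid)
open import Relation.Binary.PropositionalEquality
  using (_≡_; _≢_; refl; sym; trans; cong; cong₂; module ≡-Reasoning)
open import Relation.Nullary using (yes; no; ¬_)
import Relation.Binary.Reasoning.Setoid as SetoidReasoning

∑-cong : ∀ k {f g : Fin k → ℤ} → (∀ i → f i ≡ g i) → ∑ k f ≡ ∑ k g
∑-cong zero    e = refl
∑-cong (suc k) e = cong₂ _+_ (e zero) (∑-cong k (e ∘ suc))

∑-zero : ∀ k {f : Fin k → ℤ} → (∀ i → f i ≡ 0ℤ) → ∑ k f ≡ 0ℤ
∑-zero zero    e = refl
∑-zero (suc k) e = cong₂ _+_ (e zero) (∑-zero k (e ∘ suc))

∑-+ : ∀ k (f g : Fin k → ℤ) → ∑ k (λ i → f i + g i) ≡ ∑ k f + ∑ k g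
∑-+ zero    f g = refl
∑-+ (suc k) f g = trans (cong (f zero + g zero +_) (∑-+ k (f ∘ suc) (g ∘ suc)))
                        (interchange (f zero) (g zero) _ _)
  where
  interchange : ∀ a b c d → (a + b) + (c + d) ≡ (a + c) + (b + d)
  interchange = solve-∀

∑-neg : ∀ k (f : Fin k → ℤ) → ∑ k (λ i → - f i) ≡ - ∑ k f
∑-neg zero    f = refl
∑-neg (suc k) f = trans (cong (- f zero +_) (∑-neg k (f ∘ suc)))
                        (sym (ℤ.neg-distrib-+ (f zero) _))

∑-- : ∀ k (f g : Fin k → ℤ) → ∑ k (λ i → f i - g i) ≡ ∑ k f - ∑ k g
∑-- k f g = trans (∑-+ k f (λ i → - g i)) (cong (∑ k f +_) (∑-neg k g))

∑-*ˡ : ∀ k (c : ℤ) (f : Fin k → ℤ) → ∑ k (λ i → c * f i) ≡ c * ∑ k f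
∑-*ˡ zero    c f = sym (ℤ.*-zeroʳ c)
∑-*ˡ (suc k) c f = trans (cong (c * f zero +_) (∑-*ˡ k c (f ∘ suc)))
                         (sym (ℤ.*-distribˡ-+ c (f zero) _))

∑-*ʳ : ∀ k (c : ℤ) (f : Fin k → ℤ) → ∑ k (λ i → f i * c) ≡ ∑ k f * c
∑-*ʳ k c f = trans (∑-cong k (λ i → ℤ.*-comm (f i) c))
                   (trans (∑-*ˡ k c f) (ℤ.*-comm c _))

∑-swap : ∀ r s (f : Fin r → Fin s → ℤ) →
         ∑ r (λ i → ∑ s (f i)) ≡ ∑ s (λ j → ∑ r (λ i → f i j))
∑-swap zero    s f = sym (∑-zero s (λ _ → refl))
∑-swap (suc r) s f = trans (cong (∑ s (f zero) +_) (∑-swap r s (f ∘ suc)))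
                           (sym (∑-+ s (f zero) _))

Id-sym : ∀ {k} (i j : Fin k) → Id i j ≡ Id j i
Id-sym zero    zero    = refl
Id-sym zero    (suc j) = refl
Id-sym (suc i) zero    = refl
Id-sym (suc i) (suc j) = Id-sym i j

∑-Idˡ : ∀ k (i : Fin k) (f : Fin k → ℤ) → ∑ k (λ j → Id i j * f j) ≡ f i
∑-Idˡ (suc k) zero    f = trans (cong₂ _+_ (ℤ.*-identityˡ (f zero)) (∑-zero k (λ _ → refl)))
                                (ℤ.+-identityʳ (f zero))
∑-Idˡ (suc k) (suc i) f = trans (ℤ.+-identityˡ _) (∑-Idˡ k i (f ∘ suc))

∑-Idʳ : ∀ k (i : Fin k) (f : Fin k → ℤ) → ∑ k (λ j → f j * Id j i) ≡ f i
∑-Idʳ k i f = trans (∑-cong k (λ j → trans (ℤ.*-comm (f j) _) (cong (_* f j) (Id-sym j i))))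
                    (∑-Idˡ k i f)

≈-refl : ∀ {r s} {A : Mat r s} → A ≈ A
≈-refl i j = refl

≈-sym : ∀ {r s} {A B : Mat r s} → A ≈ B → B ≈ A
≈-sym e i j = sym (e i j)

≈-trans : ∀ {r s} {A B C : Mat r s} → A ≈ B → B ≈ C → A ≈ C
≈-trans e f i j = trans (e i j) (f i j)

≈-setoid : ℕ → ℕ → Setoid 0ℓ 0ℓ
≈-setoid r s = record
  { Carrier       = Mat r s
  ; _≈_           = _≈_
  ; isEquivalence = record { refl = ≈-refl ; sym = ≈-sym ; trans = ≈-trans }
  }

module ≈-Reasoning {r s : ℕ} = SetoidReasoning (≈-setoid r s)

·-cong : ∀ {r s u} {A A′ : Mat r s} {B B′ : Mat s u} → A ≈ A′ → B ≈ B′ → A · B ≈ A′ · B′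
·-cong {s = s} e f i j = ∑-cong s (λ k → cong₂ _*_ (e i k) (f k j))

·-congˡ : ∀ {r s u} (A : Mat r s) {B B′ : Mat s u} → B ≈ B′ → A · B ≈ A · B′
·-congˡ {s = s} A e i j = ∑-cong s (λ k → cong (A i k *_) (e k j))

·-congʳ : ∀ {r s u} (B : Mat s u) {A A′ : Mat r s} → A ≈ A′ → A · B ≈ A′ · B
·-congʳ {s = s} B e i j = ∑-cong s (λ k → cong (_* B k j) (e i k))

⊕-cong : ∀ {r s} {A A′ B B′ : Mat r s} → A ≈ A′ → B ≈ B′ → A ⊕ B ≈ A′ ⊕ B′
⊕-cong e f i j = cong₂ _+_ (e i j) (f i j)

⊕-congˡ : ∀ {r s} (A : Mat r s) {B B′ : Mat r s} → B ≈ B′ → A ⊕ B ≈ A ⊕ B′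
⊕-congˡ A e i j = cong (A i j +_) (e i j)

⊖-congˡ : ∀ {r s} (A : Mat r s) {B B′ : Mat r s} → B ≈ B′ → A ⊖ B ≈ A ⊖ B′
⊖-congˡ A e i j = cong (λ b → A i j - b) (e i j)

ᵀ-cong : ∀ {r s} {A A′ : Mat r s} → A ≈ A′ → A ᵀ ≈ A′ ᵀ
ᵀ-cong e i j = e j i

·-assoc : ∀ {r s t u} (A : Mat r s) (B : Mat s t) (C : Mat t u) → (A · B) · C ≈ A · (B · C)
·-assoc {s = s} {t = t} A B C i j = begin
  ∑ t (λ l → ∑ s (λ k → A i k * B k l) * C l j)     ≡⟨ ∑-cong t (λ l → sym (∑-*ʳ s (C l j) _)) ⟩
  ∑ t (λ l → ∑ s (λ k → A i k * B k l * C l j))     ≡⟨ ∑-swap t s _ ⟩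
  ∑ s (λ k → ∑ t (λ l → A i k * B k l * C l j))     ≡⟨ ∑-cong s (λ k → ∑-cong t (λ l → ℤ.*-assoc (A i k) _ _)) ⟩
  ∑ s (λ k → ∑ t (λ l → A i k * (B k l * C l j)))   ≡⟨ ∑-cong s (λ k → ∑-*ˡ t (A i k) _) ⟩
  ∑ s (λ k → A i k * ∑ t (λ l → B k l * C l j))     ∎
  where open ≡-Reasoning

·-identityˡ : ∀ {r s} (A : Mat r s) → Id · A ≈ A
·-identityˡ {r} A i j = ∑-Idˡ r i (λ k → A k j)

·-identityʳ : ∀ {r s} (A : Mat r s) → A · Id ≈ A
·-identityʳ {s = s} A i j = ∑-Idʳ s j (A i)

·-zeroˡ : ∀ {r s u} (A : Mat s u) → 𝟘 {r} · A ≈ 𝟘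
·-zeroˡ {s = s} A i j = ∑-zero s (λ _ → refl)

·-zeroʳ : ∀ {r s u} (A : Mat r s) → A · 𝟘 {s} {u} ≈ 𝟘
·-zeroʳ {s = s} A i j = ∑-zero s (λ k → ℤ.*-zeroʳ (A i k))

·-distribˡ-⊕ : ∀ {r s u} (A : Mat r s) (B C : Mat s u) → A · (B ⊕ C) ≈ A · B ⊕ A · C
·-distribˡ-⊕ {s = s} A B C i j =
  trans (∑-cong s (λ k → ℤ.*-distribˡ-+ (A i k) (B k j) (C k j))) (∑-+ s _ _)

·-distribʳ-⊕ : ∀ {r s u} (A B : Mat r s) (C : Mat s u) → (A ⊕ B) · C ≈ A · C ⊕ B · C
·-distribʳ-⊕ {s = s} A B C i j =
  trans (∑-cong s (λ k → ℤ.*-distribʳ-+ (C k j) (A i k) (B i k))) (∑-+ s _ _)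

·-distribˡ-⊖ : ∀ {r s u} (A : Mat r s) (B C : Mat s u) → A · (B ⊖ C) ≈ A · B ⊖ A · C
·-distribˡ-⊖ {s = s} A B C i j =
  trans (∑-cong s (λ k → distrib (A i k) (B k j) (C k j))) (∑-- s _ _)
  where
  distrib : ∀ a b c → a * (b - c) ≡ a * b - a * c
  distrib = solve-∀

·-distribʳ-⊖ : ∀ {r s u} (A B : Mat r s) (C : Mat s u) → (A ⊖ B) · C ≈ A · C ⊖ B · C
·-distribʳ-⊖ {s = s} A B C i j =
  trans (∑-cong s (λ k → distrib (A i k) (B i k) (C k j))) (∑-- s _ _)
  where
  distrib : ∀ a b c → (a - b) * c ≡ a * c - b * c
  distrib = solve-∀

ᵀ-· : ∀ {r s u} (A : Mat r s) (B : Mat s u) → (A · B) ᵀ ≈ B ᵀ · A ᵀ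
ᵀ-· {s = s} A B i j = ∑-cong s (λ k → ℤ.*-comm (A j k) (B k i))

Idᵀ : ∀ {r} → Id {r} ᵀ ≈ Id
Idᵀ i j = Id-sym j i

⊕-identityʳ : ∀ {r s} (A : Mat r s) → A ⊕ 𝟘 ≈ A
⊕-identityʳ A i j = ℤ.+-identityʳ (A i j)

⊕-comm : ∀ {r s} (A B : Mat r s) → A ⊕ B ≈ B ⊕ A
⊕-comm A B i j = ℤ.+-comm (A i j) (B i j)

⊕-cancelˡ : ∀ {r s} (A : Mat r s) {B C : Mat r s} → A ⊕ B ≈ A ⊕ C → B ≈ C
⊕-cancelˡ A {B} {C} e i j =
  trans (cancel (A i j) (B i j)) (trans (cong (- A i j +_) (e i j)) (sym (cancel (A i j) (C i j))))
  where
  cancel : ∀ a b → b ≡ - a + (a + b)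
  cancel = solve-∀

⊕-⊖-cancel : ∀ {r s} (A B : Mat r s) → A ⊕ (B ⊖ A) ≈ B
⊕-⊖-cancel A B i j = cancel (A i j) (B i j)
  where
  cancel : ∀ a b → a + (b - a) ≡ b
  cancel = solve-∀

⊖≈𝟘⇒≈ : ∀ {r s} {A B : Mat r s} → A ⊖ B ≈ 𝟘 → A ≈ B
⊖≈𝟘⇒≈ e i j = ℤ.i-j≡0⇒i≡j _ _ (e i j)

≈⇒⊖≈𝟘 : ∀ {r s} {A B : Mat r s} → A ≈ B → A ⊖ B ≈ 𝟘
≈⇒⊖≈𝟘 e i j = ℤ.i≡j⇒i-j≡0 (e i j)

⊕≈𝟘⇒≈𝟘⊖ : ∀ {r s} {A B : Mat r s} → A ⊕ B ≈ 𝟘 → A ≈ 𝟘 ⊖ B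
⊕≈𝟘⇒≈𝟘⊖ {A = A} {B} e i j = trans (move (A i j) (B i j)) (cong (_- B i j) (e i j))
  where
  move : ∀ a b → a ≡ (a + b) - b
  move = solve-∀

-- One-sided inverses of square integer matrices

-- Scalars act on column vectors as 1 × 1 matrices on the right, so that ·-assoc moves them.
⟦_⟧ : ℤ → Mat 1 1
⟦ d ⟧ _ _ = d

·⟦⟧-cancel : ∀ {r} {d : ℤ} → d ≢ 0ℤ → {x y : Mat r 1} → x · ⟦ d ⟧ ≈ y · ⟦ d ⟧ → x ≈ y
·⟦⟧-cancel {d = d} d≢0 {x} {y} e i zero =
  ℤ.*-cancelʳ-≡ (x i zero) (y i zero) d {{≢-nonZero d≢0}}
    (trans (sym (ℤ.+-identityʳ _)) (trans (e i zero) (ℤ.+-identityʳ _)))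

e₀ : ∀ {k} → Mat (suc k) 1
e₀ i _ = Id i zero

e₀≉𝟘 : ∀ {k} → ¬ (e₀ {k} ≈ 𝟘)
e₀≉𝟘 e with e zero zero
... | ()

wide⇒nontrivialKernel : ∀ {n} (M : Mat n (suc n)) →
                        Σ (Mat (suc n) 1) λ a → ¬ (a ≈ 𝟘) × M · a ≈ 𝟘
wide⇒nontrivialKernel {zero} M = e₀ , e₀≉𝟘 , λ ()
wide⇒nontrivialKernel {suc n} M with all? (λ i → M i zero ℤ.≟ 0ℤ)
... | yes column₀≈𝟘 = e₀ , e₀≉𝟘 , λ i _ → trans (·-identityʳ M i zero) (column₀≈𝟘 i)
... | no column₀≉𝟘 = a , a≉𝟘 , Ma≈𝟘
  where
  pivot = ¬∀⟶∃¬ (suc n) _ (λ i → M i zero ℤ.≟ 0ℤ) column₀≉𝟘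
  p = proj₁ pivot
  π = M p zero

  -- Gaussian elimination of column zero against the pivot row p, which is then dropped.
  M′ : Mat n (suc n)
  M′ i j = π * M (punchIn p i) (suc j) - M (punchIn p i) zero * M p (suc j)

  kernel′ = wide⇒nontrivialKernel M′
  b = proj₁ kernel′

  T : Fin (suc n) → ℤ
  T r = ∑ (suc n) (λ j → M r (suc j) * b j zero)

  a : Mat (suc (suc n)) 1
  a zero    _ = - T p
  a (suc j) _ = π * b j zero

  Ma-row : ∀ r → (M · a) r zero ≡ π * T r - M r zero * T p
  Ma-row r = trans (cong (M r zero * - T p +_)
                     (trans (∑-cong (suc n) (λ j → rearrange (M r (suc j)) π (b j zero)))
                            (∑-*ˡ (suc n) π (λ j → M r (suc j) * b j zero))))
                   (swap (M r zero) (T p) (π * T r))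
    where
    rearrange : ∀ m x y → m * (x * y) ≡ x * (m * y)
    rearrange = solve-∀
    swap : ∀ m t u → m * - t + u ≡ u - m * t
    swap = solve-∀

  M′b-row : ∀ i → (M′ · b) i zero ≡ π * T (punchIn p i) - M (punchIn p i) zero * T p
  M′b-row i = trans (∑-cong (suc n) (λ j → expand π (M r (suc j)) (M r zero) (M p (suc j)) (b j zero)))
                    (trans (∑-- (suc n) (λ j → π * (M r (suc j) * b j zero))
                                        (λ j → M r zero * (M p (suc j) * b j zero)))
                           (cong₂ _-_ (∑-*ˡ (suc n) π (λ j → M r (suc j) * b j zero))
                                      (∑-*ˡ (suc n) (M r zero) (λ j → M p (suc j) * b j zero))))
    where
    r = punchIn p i
    expand : ∀ x m y q z → (x * m - y * q) * z ≡ x * (m * z) - y * (q * z)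
    expand = solve-∀

  Ma≈𝟘 : M · a ≈ 𝟘
  Ma≈𝟘 r zero with p ≟ᶠ r
  ... | yes refl = trans (Ma-row p) (ℤ.+-inverseʳ (π * T p))
  ... | no p≢r   = begin
    (M · a) r zero                              ≡⟨ Ma-row r ⟩
    π * T r - M r zero * T p                    ≡⟨ cong (λ r → π * T r - M r zero * T p) (sym (punchIn-punchOut p≢r)) ⟩
    π * T (punchIn p i) - M (punchIn p i) zero * T p ≡⟨ sym (M′b-row i) ⟩
    (M′ · b) i zero                             ≡⟨ proj₂ (proj₂ kernel′) i zero ⟩
    0ℤ                                          ∎
    where
    open ≡-Reasoning
    i = punchOut p≢r

  a≉𝟘 : ¬ (a ≈ 𝟘)
  a≉𝟘 a≈𝟘 = proj₁ (proj₂ kernel′) b≈𝟘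
    where
    b≈𝟘 : b ≈ 𝟘
    b≈𝟘 j zero with ℤ.i*j≡0⇒i≡0∨j≡0 π (a≈𝟘 (suc j) zero)
    ... | inj₁ π≡0 = ⊥-elim (proj₂ pivot π≡0)
    ... | inj₂ bⱼ≡0 = bⱼ≡0

rightInverse⇒leftInverse : ∀ {n} (A B : Mat n n) → A · B ≈ Id → B · A ≈ Id
rightInverse⇒leftInverse {n} A B AB≈Id i j =
  -- column j of B · A is B · (A · eⱼ)
  trans (·-congˡ B (≈-sym (·-identityʳ A)) i j) (BAx≈x (λ k _ → Id k j) i zero)
  where
  B-injective : ∀ {u} (y : Mat n u) → B · y ≈ 𝟘 → y ≈ 𝟘
  B-injective y By≈𝟘 = begin
    y             ≈⟨ ·-identityˡ y ⟨
    Id · y        ≈⟨ ·-congʳ y AB≈Id ⟨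
    (A · B) · y   ≈⟨ ·-assoc A B y ⟩
    A · (B · y)   ≈⟨ ·-congˡ A By≈𝟘 ⟩
    A · 𝟘         ≈⟨ ·-zeroʳ A ⟩
    𝟘             ∎
    where open ≈-Reasoning

  -- The n + 1 columns of x ∣ B are dependent, and the coefficient of x cannot vanish
  -- because B is injective.
  multipleInImage : ∀ (x : Mat n 1) → Σ ℤ λ d → d ≢ 0ℤ × Σ (Mat n 1) λ w → x · ⟦ d ⟧ ≈ B · w
  multipleInImage x = fromKernelVector (wide⇒nontrivialKernel x∣B)
    where
    x∣B : Mat n (suc n)
    x∣B i zero    = x i zero
    x∣B i (suc k) = B i k

    fromKernelVector : Σ (Mat (suc n) 1) (λ a → ¬ (a ≈ 𝟘) × x∣B · a ≈ 𝟘) →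
                       Σ ℤ λ d → d ≢ 0ℤ × Σ (Mat n 1) λ w → x · ⟦ d ⟧ ≈ B · w
    fromKernelVector (a , a≉𝟘 , x∣Ba≈𝟘) with a zero zero ℤ.≟ 0ℤ
    ... | yes a₀≡0 = ⊥-elim (a≉𝟘 a≈𝟘)
      where
      a′≈𝟘 : (λ k → a (suc k)) ≈ 𝟘
      a′≈𝟘 = B-injective (λ k → a (suc k)) λ { i zero → begin
        (B · (λ k → a (suc k))) i zero                  ≡⟨ ℤ.+-identityˡ _ ⟨
        0ℤ + (B · (λ k → a (suc k))) i zero             ≡⟨ cong (_+ _) (trans (cong (x i zero *_) a₀≡0) (ℤ.*-zeroʳ (x i zero))) ⟨
        x i zero * a zero zero + (B · (λ k → a (suc k))) i zero ≡⟨ x∣Ba≈𝟘 i zero ⟩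
        0ℤ                                              ∎ }
        where open ≡-Reasoning
      a≈𝟘 : a ≈ 𝟘
      a≈𝟘 zero    zero = a₀≡0
      a≈𝟘 (suc k) zero = a′≈𝟘 k zero
    ... | no a₀≢0 = - a zero zero , a₀≢0 ∘ ℤ.neg-injective , a′ , λ { i zero →
      trans (rearrange (x i zero) (a zero zero) ((B · a′) i zero))
            (trans (cong (λ t → (B · a′) i zero - t) (x∣Ba≈𝟘 i zero)) (ℤ.+-identityʳ _)) }
      where
      a′ : Mat n 1
      a′ k = a (suc k)
      rearrange : ∀ x a s → x * - a + 0ℤ ≡ s - (x * a + s)
      rearrange = solve-∀

  BAx≈x : ∀ x → B · (A · x) ≈ x
  BAx≈x x with multipleInImage x
  ... | d , d≢0 , w , xd≈Bw = ·⟦⟧-cancel d≢0 (begin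
    (B · (A · x)) · ⟦ d ⟧   ≈⟨ ·-assoc B (A · x) ⟦ d ⟧ ⟩
    B · ((A · x) · ⟦ d ⟧)   ≈⟨ ·-congˡ B (·-assoc A x ⟦ d ⟧) ⟩
    B · (A · (x · ⟦ d ⟧))   ≈⟨ ·-congˡ B (·-congˡ A xd≈Bw) ⟩
    B · (A · (B · w))       ≈⟨ ·-congˡ B (·-assoc A B w) ⟨
    B · ((A · B) · w)       ≈⟨ ·-congˡ B (·-congʳ w AB≈Id) ⟩
    B · (Id · w)            ≈⟨ ·-congˡ B (·-identityˡ w) ⟩
    B · w                   ≈⟨ xd≈Bw ⟨
    x · ⟦ d ⟧               ∎)
    where open ≈-Reasoning

rightInverse⇒invertible : ∀ {n} (B C : Mat n n) → B · C ≈ Id → Invertible B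
rightInverse⇒invertible B C BC≈Id = C , BC≈Id , rightInverse⇒leftInverse B C BC≈Id

leftInverse⇒invertible : ∀ {n} (B C : Mat n n) → C · B ≈ Id → Invertible B
leftInverse⇒invertible B C CB≈Id = C , rightInverse⇒leftInverse C B CB≈Id , CB≈Id

module _ {p r c} (A : Mat p r) (K : Mat r c) (K-kernel : IsKernelMatrix A K) where

  kernelMatrix-factor : ∀ {u} (M : Mat r u) → A · M ≈ 𝟘 → Σ (Mat c u) λ Y → K · Y ≈ M
  kernelMatrix-factor M AM≈𝟘 = (λ k j → proj₁ (column j) k zero) , λ i j → proj₂ (column j) i zero
    where
    column = λ j → proj₁ (proj₂ K-kernel) (λ i _ → M i j) (λ i _ → AM≈𝟘 i j)

  kernelMatrix-cancelˡ : ∀ {u} {X Y : Mat c u} → K · X ≈ K · Y → X ≈ Y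
  kernelMatrix-cancelˡ {X = X} {Y} KX≈KY = ⊖≈𝟘⇒≈ λ k j →
    proj₂ (proj₂ K-kernel) (λ k _ → (X ⊖ Y) k j)
          (λ i _ → trans (·-distribˡ-⊖ K X Y i j) (≈⇒⊖≈𝟘 KX≈KY i j)) k zero

-- Pseudo-endomorphisms

module PseudoEndomorphisms {p N c} (I : Mat p N) (G G⁻¹ : Mat N N)
  (G+Gᵀ≈IᵀI : G ⊕ G ᵀ ≈ I ᵀ · I) (G⁻¹-inverse : IsInverse G G⁻¹)
  (K : Mat N c) (K-kernel : IsKernelMatrix I K) where

  K† : Mat N c
  K† = G · K

  I† : Mat p N
  I† = I · G⁻¹

  W : Mat c c
  W = K ᵀ · G · K

  _⋆_ : Mat c c → Mat c c → Mat c c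
  X ⋆ Y = X ⊕ Y ⊖ X · W · Y

  sandwich : Mat c c → Mat N N
  sandwich Z = K · Z · K† ᵀ

  Υ : Mat c c → Mat N N
  Υ Z = Id ⊕ sandwich Z

  PsEnd : Mat N N → Set
  PsEnd B = (I · B ≈ I) × (I† · B ᵀ ≈ I†)

  G⁻¹·K†·X≈K·X : ∀ {u} (X : Mat c u) → G⁻¹ · (K† · X) ≈ K · X
  G⁻¹·K†·X≈K·X X = begin
    G⁻¹ · ((G · K) · X)   ≈⟨ ·-congˡ G⁻¹ (·-assoc G K X) ⟩
    G⁻¹ · (G · (K · X))   ≈⟨ ·-assoc G⁻¹ G (K · X) ⟨
    (G⁻¹ · G) · (K · X)   ≈⟨ ·-congʳ (K · X) (proj₂ G⁻¹-inverse) ⟩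
    Id · (K · X)          ≈⟨ ·-identityˡ (K · X) ⟩
    K · X                 ∎
    where open ≈-Reasoning

  G·G⁻¹·X≈X : ∀ {u} (X : Mat N u) → G · (G⁻¹ · X) ≈ X
  G·G⁻¹·X≈X X = begin
    G · (G⁻¹ · X)   ≈⟨ ·-assoc G G⁻¹ X ⟨
    (G · G⁻¹) · X   ≈⟨ ·-congʳ X (proj₁ G⁻¹-inverse) ⟩
    Id · X          ≈⟨ ·-identityˡ X ⟩
    X               ∎
    where open ≈-Reasoning

  I·K·X≈𝟘 : ∀ {u} (X : Mat c u) → I · (K · X) ≈ 𝟘
  I·K·X≈𝟘 X = begin
    I · (K · X)   ≈⟨ ·-assoc I K X ⟨
    (I · K) · X   ≈⟨ ·-congʳ X (proj₁ K-kernel) ⟩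
    𝟘 · X         ≈⟨ ·-zeroˡ X ⟩
    𝟘             ∎
    where open ≈-Reasoning

  K†-cancelˡ : ∀ {u} {X Y : Mat c u} → K† · X ≈ K† · Y → X ≈ Y
  K†-cancelˡ {X = X} {Y} e = kernelMatrix-cancelˡ I K K-kernel
    (≈-trans (≈-sym (G⁻¹·K†·X≈K·X X)) (≈-trans (·-congˡ G⁻¹ e) (G⁻¹·K†·X≈K·X Y)))

  K†ᵀ-cancelʳ : ∀ {u} {X Y : Mat u c} → X · K† ᵀ ≈ Y · K† ᵀ → X ≈ Y
  K†ᵀ-cancelʳ {X = X} {Y} e i j = K†-cancelˡ {X = X ᵀ} {Y ᵀ}
    (≈-trans (≈-sym (ᵀ-· X (K† ᵀ))) (≈-trans (ᵀ-cong e) (ᵀ-· Y (K† ᵀ)))) j i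

  Υ-cong : ∀ {X Y} → X ≈ Y → Υ X ≈ Υ Y
  Υ-cong e = ⊕-congˡ Id (·-congʳ (K† ᵀ) (·-congˡ K e))

  Υ-zero : Υ 𝟘 ≈ Id
  Υ-zero = ≈-trans (⊕-congˡ Id (≈-trans (·-congʳ (K† ᵀ) (·-zeroʳ K)) (·-zeroˡ (K† ᵀ))))
                   (⊕-identityʳ Id)

  Υ-injective : ∀ X Y → Υ X ≈ Υ Y → X ≈ Y
  Υ-injective X Y e = kernelMatrix-cancelˡ I K K-kernel (K†ᵀ-cancelʳ (⊕-cancelˡ Id e))

  Υ-pseudoEndomorphism : ∀ Z → PsEnd (Υ Z)
  Υ-pseudoEndomorphism Z = I·Υ≈I , I†·Υᵀ≈I†
    where
    open ≈-Reasoning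
    I·Υ≈I : I · Υ Z ≈ I
    I·Υ≈I = begin
      I · (Id ⊕ (K · Z) · K† ᵀ)          ≈⟨ ·-distribˡ-⊕ I Id _ ⟩
      I · Id ⊕ I · ((K · Z) · K† ᵀ)      ≈⟨ ⊕-cong (·-identityʳ I) (·-congˡ I (·-assoc K Z (K† ᵀ))) ⟩
      I ⊕ I · (K · (Z · K† ᵀ))           ≈⟨ ⊕-congˡ I (I·K·X≈𝟘 (Z · K† ᵀ)) ⟩
      I ⊕ 𝟘                              ≈⟨ ⊕-identityʳ I ⟩
      I                                  ∎
    I†·Υᵀ≈I† : I† · Υ Z ᵀ ≈ I†
    I†·Υᵀ≈I† = begin
      I† · Υ Z ᵀ                            ≈⟨ ·-congˡ I† (⊕-cong Idᵀ (ᵀ-· (K · Z) (K† ᵀ))) ⟩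
      I† · (Id ⊕ K† · (K · Z) ᵀ)            ≈⟨ ·-distribˡ-⊕ I† Id _ ⟩
      I† · Id ⊕ I† · (K† · (K · Z) ᵀ)       ≈⟨ ⊕-cong (·-identityʳ I†) (·-assoc I G⁻¹ _) ⟩
      I† ⊕ I · (G⁻¹ · (K† · (K · Z) ᵀ))     ≈⟨ ⊕-congˡ I† (·-congˡ I (G⁻¹·K†·X≈K·X ((K · Z) ᵀ))) ⟩
      I† ⊕ I · (K · (K · Z) ᵀ)              ≈⟨ ⊕-congˡ I† (I·K·X≈𝟘 ((K · Z) ᵀ)) ⟩
      I† ⊕ 𝟘                                ≈⟨ ⊕-identityʳ I† ⟩
      I†                                    ∎

  -- The second condition puts Bᵀ − Id into the image of K† = G K, so B − Id = Yᵀ K†ᵀ;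
  -- the first condition then puts Yᵀ into the image of K.
  Υ-surjective : ∀ B → PsEnd B → Σ (Mat c c) λ Z → Υ Z ≈ B
  Υ-surjective B (I·B≈I , I†·Bᵀ≈I†) = Z , ΥZ≈B
    where
    open ≈-Reasoning
    I·G⁻¹·[Bᵀ⊖Id]≈𝟘 : I · (G⁻¹ · (B ᵀ ⊖ Id)) ≈ 𝟘
    I·G⁻¹·[Bᵀ⊖Id]≈𝟘 = begin
      I · (G⁻¹ · (B ᵀ ⊖ Id))   ≈⟨ ·-assoc I G⁻¹ _ ⟨
      I† · (B ᵀ ⊖ Id)          ≈⟨ ·-distribˡ-⊖ I† (B ᵀ) Id ⟩
      I† · B ᵀ ⊖ I† · Id       ≈⟨ ≈⇒⊖≈𝟘 (≈-trans I†·Bᵀ≈I† (≈-sym (·-identityʳ I†))) ⟩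
      𝟘                        ∎
    Y-factorisation = kernelMatrix-factor I K K-kernel _ I·G⁻¹·[Bᵀ⊖Id]≈𝟘
    Y = proj₁ Y-factorisation
    Yᵀ·K†ᵀ≈B⊖Id : Y ᵀ · K† ᵀ ≈ B ⊖ Id
    Yᵀ·K†ᵀ≈B⊖Id = begin
      Y ᵀ · K† ᵀ                   ≈⟨ ᵀ-· K† Y ⟨
      ((G · K) · Y) ᵀ              ≈⟨ ᵀ-cong (·-assoc G K Y) ⟩
      (G · (K · Y)) ᵀ              ≈⟨ ᵀ-cong (·-congˡ G (proj₂ Y-factorisation)) ⟩
      (G · (G⁻¹ · (B ᵀ ⊖ Id))) ᵀ   ≈⟨ ᵀ-cong (G·G⁻¹·X≈X (B ᵀ ⊖ Id)) ⟩
      B ⊖ Id ᵀ                     ≈⟨ ⊖-congˡ B Idᵀ ⟩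
      B ⊖ Id                       ∎
    I·Yᵀ≈𝟘 : I · Y ᵀ ≈ 𝟘
    I·Yᵀ≈𝟘 = K†ᵀ-cancelʳ {X = I · Y ᵀ} {𝟘} (begin
      (I · Y ᵀ) · K† ᵀ   ≈⟨ ·-assoc I (Y ᵀ) (K† ᵀ) ⟩
      I · (Y ᵀ · K† ᵀ)   ≈⟨ ·-congˡ I Yᵀ·K†ᵀ≈B⊖Id ⟩
      I · (B ⊖ Id)       ≈⟨ ·-distribˡ-⊖ I B Id ⟩
      I · B ⊖ I · Id     ≈⟨ ≈⇒⊖≈𝟘 (≈-trans I·B≈I (≈-sym (·-identityʳ I))) ⟩
      𝟘                  ≈⟨ ·-zeroˡ (K† ᵀ) ⟨
      𝟘 · K† ᵀ           ∎)
    Z-factorisation = kernelMatrix-factor I K K-kernel (Y ᵀ) I·Yᵀ≈𝟘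
    Z = proj₁ Z-factorisation
    ΥZ≈B : Υ Z ≈ B
    ΥZ≈B = begin
      Id ⊕ (K · Z) · K† ᵀ   ≈⟨ ⊕-congˡ Id (·-congʳ (K† ᵀ) (proj₂ Z-factorisation)) ⟩
      Id ⊕ Y ᵀ · K† ᵀ       ≈⟨ ⊕-congˡ Id Yᵀ·K†ᵀ≈B⊖Id ⟩
      Id ⊕ (B ⊖ Id)         ≈⟨ ⊕-⊖-cancel Id B ⟩
      B                     ∎

  K†ᵀK⊕W≈𝟘 : K† ᵀ · K ⊕ W ≈ 𝟘
  K†ᵀK⊕W≈𝟘 = begin
    (G · K) ᵀ · K ⊕ (K ᵀ · G) · K        ≈⟨ ⊕-cong (·-congʳ K (ᵀ-· G K)) ≈-refl ⟩
    (K ᵀ · G ᵀ) · K ⊕ (K ᵀ · G) · K      ≈⟨ ·-distribʳ-⊕ (K ᵀ · G ᵀ) (K ᵀ · G) K ⟨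
    (K ᵀ · G ᵀ ⊕ K ᵀ · G) · K            ≈⟨ ·-congʳ K (·-distribˡ-⊕ (K ᵀ) (G ᵀ) G) ⟨
    (K ᵀ · (G ᵀ ⊕ G)) · K                ≈⟨ ·-congʳ K (·-congˡ (K ᵀ) (≈-trans (⊕-comm (G ᵀ) G) G+Gᵀ≈IᵀI)) ⟩
    (K ᵀ · (I ᵀ · I)) · K                ≈⟨ ·-assoc (K ᵀ) (I ᵀ · I) K ⟩
    K ᵀ · ((I ᵀ · I) · K)                ≈⟨ ·-congˡ (K ᵀ) (·-assoc (I ᵀ) I K) ⟩
    K ᵀ · (I ᵀ · (I · K))                ≈⟨ ·-congˡ (K ᵀ) (·-congˡ (I ᵀ) (proj₁ K-kernel)) ⟩
    K ᵀ · (I ᵀ · 𝟘)                      ≈⟨ ·-congˡ (K ᵀ) (·-zeroʳ (I ᵀ)) ⟩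
    K ᵀ · 𝟘                              ≈⟨ ·-zeroʳ (K ᵀ) ⟩
    𝟘                                    ∎
    where open ≈-Reasoning

  sandwich-⊕ : ∀ X Y → sandwich (X ⊕ Y) ≈ sandwich X ⊕ sandwich Y
  sandwich-⊕ X Y = ≈-trans (·-congʳ (K† ᵀ) (·-distribˡ-⊕ K X Y)) (·-distribʳ-⊕ (K · X) (K · Y) (K† ᵀ))

  sandwich-⊖ : ∀ X Y → sandwich (X ⊖ Y) ≈ sandwich X ⊖ sandwich Y
  sandwich-⊖ X Y = ≈-trans (·-congʳ (K† ᵀ) (·-distribˡ-⊖ K X Y)) (·-distribʳ-⊖ (K · X) (K · Y) (K† ᵀ))

  sandwich-· : ∀ X Y → sandwich X · sandwich Y ≈ sandwich (X · (K† ᵀ · K) · Y)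
  sandwich-· X Y = begin
    ((K · X) · K† ᵀ) · ((K · Y) · K† ᵀ)   ≈⟨ ·-assoc ((K · X) · K† ᵀ) (K · Y) (K† ᵀ) ⟨
    (((K · X) · K† ᵀ) · (K · Y)) · K† ᵀ   ≈⟨ ·-congʳ (K† ᵀ) middle ⟩
    (K · ((X · (K† ᵀ · K)) · Y)) · K† ᵀ   ∎
    where
    open ≈-Reasoning
    middle : ((K · X) · K† ᵀ) · (K · Y) ≈ K · ((X · (K† ᵀ · K)) · Y)
    middle = begin
      ((K · X) · K† ᵀ) · (K · Y)     ≈⟨ ·-assoc (K · X) (K† ᵀ) (K · Y) ⟩
      (K · X) · (K† ᵀ · (K · Y))     ≈⟨ ·-congˡ (K · X) (·-assoc (K† ᵀ) K Y) ⟨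
      (K · X) · ((K† ᵀ · K) · Y)     ≈⟨ ·-assoc (K · X) (K† ᵀ · K) Y ⟨
      ((K · X) · (K† ᵀ · K)) · Y     ≈⟨ ·-congʳ Y (·-assoc K X (K† ᵀ · K)) ⟩
      (K · (X · (K† ᵀ · K))) · Y     ≈⟨ ·-assoc K (X · (K† ᵀ · K)) Y ⟩
      K · ((X · (K† ᵀ · K)) · Y)     ∎

  sandwich-·-sandwich : ∀ X Y → sandwich X · sandwich Y ≈ 𝟘 ⊖ sandwich (X · W · Y)
  sandwich-·-sandwich X Y = ⊕≈𝟘⇒≈𝟘⊖ (begin
    sandwich X · sandwich Y ⊕ sandwich (X · W · Y)              ≈⟨ ⊕-cong (sandwich-· X Y) ≈-refl ⟩
    sandwich (X · (K† ᵀ · K) · Y) ⊕ sandwich (X · W · Y)        ≈⟨ sandwich-⊕ (X · (K† ᵀ · K) · Y) (X · W · Y) ⟨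
    sandwich (X · (K† ᵀ · K) · Y ⊕ X · W · Y)                   ≈⟨ ·-congʳ (K† ᵀ) (·-congˡ K middle) ⟩
    sandwich 𝟘                                                  ≈⟨ ·-congʳ (K† ᵀ) (·-zeroʳ K) ⟩
    𝟘 · K† ᵀ                                                    ≈⟨ ·-zeroˡ (K† ᵀ) ⟩
    𝟘                                                           ∎)
    where
    open ≈-Reasoning
    middle : X · (K† ᵀ · K) · Y ⊕ X · W · Y ≈ 𝟘
    middle = begin
      X · (K† ᵀ · K) · Y ⊕ X · W · Y      ≈⟨ ·-distribʳ-⊕ (X · (K† ᵀ · K)) (X · W) Y ⟨
      (X · (K† ᵀ · K) ⊕ X · W) · Y        ≈⟨ ·-congʳ Y (·-distribˡ-⊕ X (K† ᵀ · K) W) ⟨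
      X · (K† ᵀ · K ⊕ W) · Y              ≈⟨ ·-congʳ Y (·-congˡ X K†ᵀK⊕W≈𝟘) ⟩
      X · 𝟘 · Y                           ≈⟨ ·-congʳ Y (·-zeroʳ X) ⟩
      𝟘 · Y                               ≈⟨ ·-zeroˡ Y ⟩
      𝟘                                   ∎

  Υ-· : ∀ X Y → Υ X · Υ Y ≈ Υ (X ⋆ Y)
  Υ-· X Y = begin
    (Id ⊕ sandwich X) · Υ Y                              ≈⟨ ·-distribʳ-⊕ Id (sandwich X) (Υ Y) ⟩
    Id · Υ Y ⊕ sandwich X · (Id ⊕ sandwich Y)            ≈⟨ ⊕-cong (·-identityˡ (Υ Y)) (·-distribˡ-⊕ (sandwich X) Id (sandwich Y)) ⟩
    Υ Y ⊕ (sandwich X · Id ⊕ sandwich X · sandwich Y)    ≈⟨ ⊕-congˡ (Υ Y) (⊕-cong (·-identityʳ (sandwich X)) (sandwich-·-sandwich X Y)) ⟩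
    Υ Y ⊕ (sandwich X ⊕ (𝟘 ⊖ sandwich (X · W · Y)))     ≈⟨ rearrange ⟩
    Id ⊕ (sandwich (X ⊕ Y) ⊖ sandwich (X · W · Y))       ≈⟨ ⊕-congˡ Id (sandwich-⊖ (X ⊕ Y) (X · W · Y)) ⟨
    Υ (X ⋆ Y)                                            ∎
    where
    open ≈-Reasoning
    rearrange : Υ Y ⊕ (sandwich X ⊕ (𝟘 ⊖ sandwich (X · W · Y))) ≈
                Id ⊕ (sandwich (X ⊕ Y) ⊖ sandwich (X · W · Y))
    rearrange i j =
      trans (regroup (Id i j) (sandwich Y i j) (sandwich X i j) (sandwich (X · W · Y) i j))
            (cong (λ t → Id i j + (t - sandwich (X · W · Y) i j)) (sym (sandwich-⊕ X Y i j)))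
      where
      regroup : ∀ e y x w → (e + y) + (x + (0ℤ - w)) ≡ e + ((x + y) - w)
      regroup = solve-∀

  Υ-·≈Id⇔⋆≈𝟘 : ∀ X Y → (Υ X · Υ Y ≈ Id) ⇔ (X ⋆ Y ≈ 𝟘)
  Υ-·≈Id⇔⋆≈𝟘 X Y = mk⇔
    (λ e → Υ-injective (X ⋆ Y) 𝟘 (≈-trans (≈-sym (Υ-· X Y)) (≈-trans e (≈-sym Υ-zero))))
    (λ e → ≈-trans (Υ-· X Y) (≈-trans (Υ-cong e) Υ-zero))

  PsEnd-inverse : ∀ {B C} → PsEnd B → B · C ≈ Id → C · B ≈ Id → PsEnd C
  PsEnd-inverse {B} {C} (I·B≈I , I†·Bᵀ≈I†) BC≈Id CB≈Id = I·C≈I , I†·Cᵀ≈I†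
    where
    open ≈-Reasoning
    I·C≈I : I · C ≈ I
    I·C≈I = begin
      I · C         ≈⟨ ·-congʳ C I·B≈I ⟨
      (I · B) · C   ≈⟨ ·-assoc I B C ⟩
      I · (B · C)   ≈⟨ ·-congˡ I BC≈Id ⟩
      I · Id        ≈⟨ ·-identityʳ I ⟩
      I             ∎
    I†·Cᵀ≈I† : I† · C ᵀ ≈ I†
    I†·Cᵀ≈I† = begin
      I† · C ᵀ           ≈⟨ ·-congʳ (C ᵀ) I†·Bᵀ≈I† ⟨
      (I† · B ᵀ) · C ᵀ   ≈⟨ ·-assoc I† (B ᵀ) (C ᵀ) ⟩
      I† · (B ᵀ · C ᵀ)   ≈⟨ ·-congˡ I† (ᵀ-· C B) ⟨
      I† · (C · B) ᵀ     ≈⟨ ·-congˡ I† (≈-trans (ᵀ-cong CB≈Id) Idᵀ) ⟩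
      I† · Id            ≈⟨ ·-identityʳ I† ⟩
      I†                 ∎

  -- Opaque, so that the typechecker never unfolds Ξ into the construction of Υ-surjective.
  opaque
    Ξ : (B : Mat N N) → PsEnd B → Mat c c
    Ξ B p = proj₁ (Υ-surjective B p)

    Υ-Ξ : ∀ B p → Υ (Ξ B p) ≈ B
    Υ-Ξ B p = proj₂ (Υ-surjective B p)

  Ξ-Υ : ∀ Z p → Ξ (Υ Z) p ≈ Z
  Ξ-Υ Z p = Υ-injective (Ξ (Υ Z) p) Z (Υ-Ξ (Υ Z) p)

  Ξ-· : ∀ B B′ p p′ (q : PsEnd (B · B′)) → Ξ (B · B′) q ≈ Ξ B p ⋆ Ξ B′ p′
  Ξ-· B B′ p p′ q = Υ-injective _ _ (begin
    Υ (Ξ (B · B′) q)            ≈⟨ Υ-Ξ (B · B′) q ⟩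
    B · B′                      ≈⟨ ·-cong (Υ-Ξ B p) (Υ-Ξ B′ p′) ⟨
    Υ (Ξ B p) · Υ (Ξ B′ p′)     ≈⟨ Υ-· (Ξ B p) (Ξ B′ p′) ⟩
    Υ (Ξ B p ⋆ Ξ B′ p′)         ∎)
    where open ≈-Reasoning

  Ξ-Id : ∀ p → Ξ Id p ≈ 𝟘
  Ξ-Id p = Υ-injective (Ξ Id p) 𝟘 (≈-trans (Υ-Ξ Id p) (≈-sym Υ-zero))

  invertible⇔rightQuasiInverse : ∀ B p → Invertible B ⇔ Σ (Mat c c) λ Z → Ξ B p ⋆ Z ≈ 𝟘
  invertible⇔rightQuasiInverse B p = mk⇔ to from
    where
    to : Invertible B → Σ (Mat c c) λ Z → Ξ B p ⋆ Z ≈ 𝟘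
    to (C , BC≈Id , CB≈Id) = Ξ C pC , Equivalence.to (Υ-·≈Id⇔⋆≈𝟘 (Ξ B p) (Ξ C pC))
      (≈-trans (·-cong (Υ-Ξ B p) (Υ-Ξ C pC)) BC≈Id)
      where pC = PsEnd-inverse p BC≈Id CB≈Id
    from : (Σ (Mat c c) λ Z → Ξ B p ⋆ Z ≈ 𝟘) → Invertible B
    from (Z , e) = rightInverse⇒invertible B (Υ Z)
      (≈-trans (·-congʳ (Υ Z) (≈-sym (Υ-Ξ B p))) (Equivalence.from (Υ-·≈Id⇔⋆≈𝟘 (Ξ B p) Z) e))

  invertible⇔leftQuasiInverse : ∀ B p → Invertible B ⇔ Σ (Mat c c) λ Z → Z ⋆ Ξ B p ≈ 𝟘
  invertible⇔leftQuasiInverse B p = mk⇔ to from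
    where
    to : Invertible B → Σ (Mat c c) λ Z → Z ⋆ Ξ B p ≈ 𝟘
    to (C , BC≈Id , CB≈Id) = Ξ C pC , Equivalence.to (Υ-·≈Id⇔⋆≈𝟘 (Ξ C pC) (Ξ B p))
      (≈-trans (·-cong (Υ-Ξ C pC) (Υ-Ξ B p)) CB≈Id)
      where pC = PsEnd-inverse p BC≈Id CB≈Id
    from : (Σ (Mat c c) λ Z → Z ⋆ Ξ B p ≈ 𝟘) → Invertible B
    from (Z , e) = leftInverse⇒invertible B (Υ Z)
      (≈-trans (·-congˡ (Υ Z) (≈-sym (Υ-Ξ B p))) (Equivalence.from (Υ-·≈Id⇔⋆≈𝟘 Z (Ξ B p)) e))

lemma3p5 : (Q : Quiver) → LoopLess Q → Connected Q →
  (G Ginv : Mat (n Q) (n Q)) → IsCheckG Q G → IsInverse G Ginv →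
  (K : Mat (n Q) (corank Q)) → IsKernelMatrix (Inc Q) K →
  let Kd : Mat (n Q) (corank Q)
      Kd = G · K
      W : Mat (corank Q) (corank Q)
      W = K ᵀ · G · K
      Υ : Mat (corank Q) (corank Q) → Mat (n Q) (n Q)
      Υ Z = Id ⊕ K · Z · Kd ᵀ
      PsEnd : Mat (n Q) (n Q) → Set
      PsEnd = IsPsEnd Q Ginv
  in
  -- Υ maps into End_ps(Q), is injective and onto End_ps(Q)
  (∀ Z → PsEnd (Υ Z))
  × (∀ Z Z′ → Υ Z ≈ Υ Z′ → Z ≈ Z′)
  × (∀ B → PsEnd B → Σ (Mat (corank Q) (corank Q)) (λ Z → Υ Z ≈ B))
  -- its inverse Ξ, with properties (a) and (b)
  × Σ ((B : Mat (n Q) (n Q)) → PsEnd B → Mat (corank Q) (corank Q)) (λ Ξ →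
      (∀ B p → Υ (Ξ B p) ≈ B)
    × (∀ Z p → Ξ (Υ Z) p ≈ Z)
    × (∀ B B′ p p′ (q : PsEnd (B · B′)) →
         Ξ (B · B′) q ≈ Ξ B p ⊕ Ξ B′ p′ ⊖ Ξ B p · W · Ξ B′ p′)
    × (∀ (p : PsEnd Id) → Ξ Id p ≈ 𝟘)
    × (∀ B p →
         (Invertible B ⇔ Σ (Mat (corank Q) (corank Q)) (λ Z → Ξ B p ⊕ Z ⊖ Ξ B p · W · Z ≈ 𝟘))
       × (Invertible B ⇔ Σ (Mat (corank Q) (corank Q)) (λ Z → Z ⊕ Ξ B p ⊖ Z · W · Ξ B p ≈ 𝟘))))
lemma3p5 Q _ _ G G⁻¹ (_ , G+Gᵀ≈IᵀI) G⁻¹-inverse K K-kernel =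
  Υ-pseudoEndomorphism , Υ-injective , Υ-surjective ,
  Ξ , Υ-Ξ , Ξ-Υ , Ξ-· , Ξ-Id ,
  λ B p → invertible⇔rightQuasiInverse B p , invertible⇔leftQuasiInverse B p
  where open PseudoEndomorphisms (Inc Q) G G⁻¹ G+Gᵀ≈IᵀI G⁻¹-inverse K K-kernel
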